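{- Let $\Delta\in\mathcal{H}_{\geq 3}$ be a hypergraph on $[d]$ and let $F$ be a formula consisting solely of atoms of the form $(c_1\not\sim c_2)$. Then there exists a unique hypergraph $\Delta_F$ on $[d]$ that is minimal among the hypergraphs $\Delta'$ satisfying: (1) $\Delta\leq\Delta'$; and (2) there is no atom $(c_1\not\sim c_2)$ of $F$ together with distinct edges $e_1,e_2\in\Delta'$ such that $\{c_1,c_2\}\subseteq e_1\cap e_2$.
   Context: A hypergraph on the vertex set $[d]$ is a collection of subsets of $[d]$ (edges) such that no proper subset of an edge is an edge. For hypergraphs, $\Delta_1\leq\Delta_2$ means that every edge of $\Delta_1$ is contained in some edge of $\Delta_2$. $\mathcal{H}_{\geq3}$ is the set of hypergraphs all of whose edges have size at least $3$. A formula on $[d]$ is a conjunction of atoms of the form $(x\sim y)$ or $(x\not\sim y)$ with $x,y\in[d]$. -}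

module Defs where

open import Data.Nat using (ℕ; _≤_)
open import Data.Fin using (Fin)
open import Data.Fin.Subset using (Subset; _⊆_; _⊂_; _∈_; ∣_∣)
open import Data.Bool using (Bool; true)
open import Data.List using (List)
open import Data.List.Membership.Propositional renaming (_∈_ to _∈ₗ_)
open import Data.Product using (Σ; ∃; _×_; _,_)
open import Data.Empty using (⊥)
open import Relation.Binary.PropositionalEquality using (_≡_; _≢_)

Family : ℕ → Set
Family d = Subset d → Bool

_∈E_ : ∀ {d} → Subset d → Family d → Set
e ∈E H = H e ≡ true

IsHypergraph : ∀ {d} → Family d → Set
IsHypergraph H = ∀ e e′ → e ∈E H → e′ ∈E H → e′ ⊂ e → ⊥

AllEdgesAtLeast3 : ∀ {d} → Family d → Set
AllEdgesAtLeast3 H = ∀ e → e ∈E H → 3 ≤ ∣ e ∣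

_≤H_ : ∀ {d} → Family d → Family d → Set
Δ₁ ≤H Δ₂ = ∀ e → e ∈E Δ₁ → ∃ λ e′ → e′ ∈E Δ₂ × e ⊆ e′

_≡H_ : ∀ {d} → Family d → Family d → Set
Δ₁ ≡H Δ₂ = ∀ e → Δ₁ e ≡ Δ₂ e

-- A formula consisting solely of atoms (c₁ ≁ c₂), listed as pairs (c₁ , c₂).
NegFormula : ℕ → Set
NegFormula d = List (Fin d × Fin d)

NoViolation : ∀ {d} → NegFormula d → Family d → Set
NoViolation F Δ′ =
  ∀ c₁ c₂ → (c₁ , c₂) ∈ₗ F → ∀ e₁ e₂ → e₁ ∈E Δ′ → e₂ ∈E Δ′ → e₁ ≢ e₂ →
  c₁ ∈ e₁ → c₂ ∈ e₁ → c₁ ∈ e₂ → c₂ ∈ e₂ → ⊥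

Admissible : ∀ {d} → Family d → NegFormula d → Family d → Set
Admissible Δ F Δ′ = IsHypergraph Δ′ × Δ ≤H Δ′ × NoViolation F Δ′

MinimalAdmissible : ∀ {d} → Family d → NegFormula d → Family d → Set
MinimalAdmissible Δ F Δ′ =
  Admissible Δ F Δ′ × (∀ Δ″ → Admissible Δ F Δ″ → Δ″ ≤H Δ′ → Δ″ ≡H Δ′)

-- Keep a list of candidate edges, initially the edges of Δ, below every
-- admissible Δ′.  If two candidates A, B share an atom of F, the edges of Δ′
-- above them share it too and hence coincide, so A ∪ B is still below Δ′; this
-- holds trivially if A ⊆ B.  Replacing such a pair by A ∪ B shortens the list,
-- and once no pair is left the candidates form an admissible hypergraph, the
-- least one.  As ≤ is antisymmetric on hypergraphs, a least admissible
-- hypergraph is the unique minimal one.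
module Submission where

open import Data.Bool using (true)
import Data.Bool as Bool
open import Data.Bool.Properties using (⇔→≡)
open import Data.Empty using (⊥-elim)
open import Data.Fin using (Fin)
open import Data.Fin.Properties using (any?)
open import Data.Fin.Subset
  using (Subset; inside; outside; _⊆_; _⊂_; _∈_; _∪_)
open import Data.Fin.Subset.Properties
  using (_∈?_; ⊆-refl; ⊆-trans; ⊆-antisym; ⊂-irref; p⊆p∪q; q⊆p∪q; x∈p∪q⁻; _⊆?_)
open import Data.List using (List; []; _∷_; filter; length; cartesianProductWith)
open import Data.List.Properties using (filter-notAll)
open import Data.List.Relation.Unary.Any as Any using (Any; here; there)
open import Data.List.Membership.Propositional using (find; lose)
  renaming (_∈_ to _∈ₗ_)
open import Data.List.Membership.Propositional.Properties
  using (∈-filter⁺; ∈-filter⁻; ∈-cartesianProductWith⁺)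
import Data.List.Membership.DecPropositional as DecMembership
open import Data.Nat using (ℕ; zero; suc; _<_)
open import Data.Nat.Induction using (<-wellFounded)
open import Data.Nat.Properties using (≤-<-trans)
open import Data.Product using (Σ; ∃; ∃₂; _×_; _,_; proj₁; proj₂)
open import Data.Sum using (_⊎_; inj₁; inj₂; [_,_]′)
open import Data.Vec using ([]; _∷_)
open import Data.Vec.Properties using (≡-dec)
open import Function using (id; _∘_)
open import Function.Bundles using (mk⇔)
open import Induction.WellFounded using (Acc; acc)
open import Relation.Binary.PropositionalEquality using (_≡_; _≢_; refl; sym; trans; subst)
open import Relation.Nullary using (Dec; yes; no; ¬_; does)
open import Relation.Nullary.Decidable
  using (_×-dec_; _⊎-dec_; ¬?; decidable-stable; dec-true)
open import Defs

private
  variable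
    n : ℕ
    p q r A B g : Subset n
    G : List (Subset n)

⊆⇒≡⊎⊂ : p ⊆ q → p ≡ q ⊎ p ⊂ q
⊆⇒≡⊎⊂ {p = p} {q} p⊆q with any? (λ x → x ∈? q ×-dec ¬? (x ∈? p))
... | yes (x , x∈q , x∉p) = inj₂ (p⊆q , x , x∈q , x∉p)
... | no ∄x∈q∖p = inj₁ (⊆-antisym p⊆q q⊆p)
  where
    q⊆p : q ⊆ p
    q⊆p {x} x∈q = decidable-stable (x ∈? p) (λ x∉p → ∄x∈q∖p (x , x∈q , x∉p))

∪-least : p ⊆ r → q ⊆ r → p ∪ q ⊆ r
∪-least {p = p} {q = q} p⊆r q⊆r x∈p∪q = [ p⊆r , q⊆r ]′ (x∈p∪q⁻ p q x∈p∪q)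

_≟ₛ_ : (p q : Subset n) → Dec (p ≡ q)
_≟ₛ_ = ≡-dec Bool._≟_

subsets : ∀ n → List (Subset n)
subsets zero = [] ∷ []
subsets (suc n) = cartesianProductWith _∷_ (inside ∷ outside ∷ []) (subsets n)

∈-subsets : (p : Subset n) → p ∈ₗ subsets n
∈-subsets [] = here refl
∈-subsets (inside ∷ p) = ∈-cartesianProductWith⁺ _∷_ {xs = inside ∷ outside ∷ []}
  (here refl) (∈-subsets p)
∈-subsets (outside ∷ p) = ∈-cartesianProductWith⁺ _∷_ {xs = inside ∷ outside ∷ []}
  (there (here refl)) (∈-subsets p)

module _ {n : ℕ} where
  open DecMembership (_≟ₛ_ {n}) using () renaming (_∈?_ to _∈ₗ?_)

  ⟦_⟧ : List (Subset n) → Family n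
  ⟦ G ⟧ s = does (s ∈ₗ? G)

  ∈E⟦⟧⁺ : ∀ {s G} → s ∈ₗ G → s ∈E ⟦ G ⟧
  ∈E⟦⟧⁺ {s} {G} = dec-true (s ∈ₗ? G)

  ∈E⟦⟧⁻ : ∀ {s G} → s ∈E ⟦ G ⟧ → s ∈ₗ G
  ∈E⟦⟧⁻ {s} {G} with s ∈ₗ? G
  ... | yes s∈G = λ _ → s∈G
  ... | no _ = λ ()

edges : Family n → List (Subset n)
edges H = filter (λ s → H s Bool.≟ true) (subsets _)

⟦edges⟧≡H : (H : Family n) → ⟦ edges H ⟧ ≡H H
⟦edges⟧≡H H s = ⇔→≡ (mk⇔ (λ s∈ → proj₂ (∈-filter⁻ P? {xs = subsets _} (∈E⟦⟧⁻ s∈)))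
                         (λ s∈H → ∈E⟦⟧⁺ (∈-filter⁺ P? (∈-subsets s) s∈H)))
  where P? = λ s → H s Bool.≟ true

≤H-reflexive : {Δ₁ Δ₂ : Family n} → Δ₁ ≡H Δ₂ → Δ₁ ≤H Δ₂
≤H-reflexive Δ₁≡Δ₂ e e∈Δ₁ = e , trans (sym (Δ₁≡Δ₂ e)) e∈Δ₁ , ⊆-refl

≤H-trans : {Δ₁ Δ₂ Δ₃ : Family n} → Δ₁ ≤H Δ₂ → Δ₂ ≤H Δ₃ → Δ₁ ≤H Δ₃
≤H-trans Δ₁≤Δ₂ Δ₂≤Δ₃ e e∈Δ₁ with Δ₁≤Δ₂ e e∈Δ₁
... | e′ , e′∈Δ₂ , e⊆e′ with Δ₂≤Δ₃ e′ e′∈Δ₂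
... | e″ , e″∈Δ₃ , e′⊆e″ = e″ , e″∈Δ₃ , ⊆-trans e⊆e′ e′⊆e″

edge-⊆-edge⇒≡ : {H : Family n} {e e′ : Subset n} → IsHypergraph H →
                e ∈E H → e′ ∈E H → e ⊆ e′ → e ≡ e′
edge-⊆-edge⇒≡ {e = e} {e′} hyp e∈H e′∈H e⊆e′ =
  [ id , (λ e⊂e′ → ⊥-elim (hyp e′ e e′∈H e∈H e⊂e′)) ]′ (⊆⇒≡⊎⊂ e⊆e′)

≤H-antisym : {Δ₁ Δ₂ : Family n} → IsHypergraph Δ₁ → IsHypergraph Δ₂ →
             Δ₁ ≤H Δ₂ → Δ₂ ≤H Δ₁ → Δ₁ ≡H Δ₂
≤H-antisym hyp₁ hyp₂ Δ₁≤Δ₂ Δ₂≤Δ₁ e =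
  ⇔→≡ (mk⇔ (≤H-edges hyp₁ Δ₁≤Δ₂ Δ₂≤Δ₁) (≤H-edges hyp₂ Δ₂≤Δ₁ Δ₁≤Δ₂))
  where
    ≤H-edges : ∀ {Δ Δ′} → IsHypergraph Δ → Δ ≤H Δ′ → Δ′ ≤H Δ → e ∈E Δ → e ∈E Δ′
    ≤H-edges {Δ} {Δ′} hyp Δ≤Δ′ Δ′≤Δ e∈Δ with Δ≤Δ′ e e∈Δ
    ... | e′ , e′∈Δ′ , e⊆e′ with Δ′≤Δ e′ e′∈Δ′
    ... | e″ , e″∈Δ , e′⊆e″ = subst (_∈E Δ′) (sym e≡e′) e′∈Δ′
      where
        e≡e″ = edge-⊆-edge⇒≡ hyp e∈Δ e″∈Δ (⊆-trans e⊆e′ e′⊆e″)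
        e≡e′ = ⊆-antisym e⊆e′ (subst (e′ ⊆_) (sym e≡e″) e′⊆e″)

Spans : Subset n → Fin n × Fin n → Set
Spans A (c₁ , c₂) = c₁ ∈ A × c₂ ∈ A

spans? : (A : Subset n) (c : Fin n × Fin n) → Dec (Spans A c)
spans? A (c₁ , c₂) = c₁ ∈? A ×-dec c₂ ∈? A

SharesAtom : NegFormula n → Subset n → Subset n → Set
SharesAtom F A B = Any (λ c → Spans A c × Spans B c) F

sharesAtom? : (F : NegFormula n) (A B : Subset n) → Dec (SharesAtom F A B)
sharesAtom? F A B = Any.any? (λ c → spans? A c ×-dec spans? B c) F

SharesAtom-mono : ∀ {F : NegFormula n} {A A′ B B′} → A ⊆ A′ → B ⊆ B′ →
                  SharesAtom F A B → SharesAtom F A′ B′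
SharesAtom-mono A⊆A′ B⊆B′ =
  Any.map (λ ((c₁∈A , c₂∈A) , (c₁∈B , c₂∈B)) →
             (A⊆A′ c₁∈A , A⊆A′ c₂∈A) , (B⊆B′ c₁∈B , B⊆B′ c₂∈B))

NoViolation⇒sharing-edges-≡ : ∀ {F : NegFormula n} {Δ′ e₁ e₂} → NoViolation F Δ′ →
                               e₁ ∈E Δ′ → e₂ ∈E Δ′ → SharesAtom F e₁ e₂ → e₁ ≡ e₂
NoViolation⇒sharing-edges-≡ {e₁ = e₁} {e₂} noViolation e₁∈Δ′ e₂∈Δ′ shared
  with e₁ ≟ₛ e₂
... | yes e₁≡e₂ = e₁≡e₂
... | no e₁≢e₂ with find shared
... | (c₁ , c₂) , atom∈F , (c₁∈e₁ , c₂∈e₁) , (c₁∈e₂ , c₂∈e₂) =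
  ⊥-elim (noViolation c₁ c₂ atom∈F e₁ e₂ e₁∈Δ′ e₂∈Δ′ e₁≢e₂ c₁∈e₁ c₂∈e₁ c₁∈e₂ c₂∈e₂)

Mergeable : NegFormula n → Subset n → Subset n → Set
Mergeable F A B = SharesAtom F A B ⊎ A ⊆ B

mergeable? : (F : NegFormula n) (A B : Subset n) → Dec (Mergeable F A B)
mergeable? F A B = sharesAtom? F A B ⊎-dec A ⊆? B

∪-⊆-edge : ∀ {F : NegFormula n} {Δ′ e₁ e₂ A B} → NoViolation F Δ′ →
           e₁ ∈E Δ′ → e₂ ∈E Δ′ → A ⊆ e₁ → B ⊆ e₂ → Mergeable F A B → A ∪ B ⊆ e₂
∪-⊆-edge noViolation e₁∈Δ′ e₂∈Δ′ A⊆e₁ B⊆e₂ (inj₁ shared) = ∪-least A⊆e₂ B⊆e₂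
  where
    e₁≡e₂ = NoViolation⇒sharing-edges-≡ noViolation e₁∈Δ′ e₂∈Δ′
              (SharesAtom-mono A⊆e₁ B⊆e₂ shared)
    A⊆e₂ = subst (_ ⊆_) e₁≡e₂ A⊆e₁
∪-⊆-edge _ _ _ _ B⊆e₂ (inj₂ A⊆B) = ∪-least (⊆-trans A⊆B B⊆e₂) B⊆e₂

Reduced : NegFormula n → List (Subset n) → Set
Reduced F G = ∀ {A B} → A ∈ₗ G → B ∈ₗ G → A ≢ B → ¬ Mergeable F A B

Reduced⇒IsHypergraph : ∀ {F : NegFormula n} {G} → Reduced F G → IsHypergraph ⟦ G ⟧
Reduced⇒IsHypergraph reduced e e′ e∈G e′∈G e′⊂e@(e′⊆e , _) =
  reduced (∈E⟦⟧⁻ e′∈G) (∈E⟦⟧⁻ e∈G) (λ e′≡e → ⊂-irref e′≡e e′⊂e) (inj₂ e′⊆e)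

Reduced⇒NoViolation : ∀ {F : NegFormula n} {G} → Reduced F G → NoViolation F ⟦ G ⟧
Reduced⇒NoViolation reduced c₁ c₂ atom∈F e₁ e₂ e₁∈G e₂∈G e₁≢e₂ c₁∈e₁ c₂∈e₁ c₁∈e₂ c₂∈e₂ =
  reduced (∈E⟦⟧⁻ e₁∈G) (∈E⟦⟧⁻ e₂∈G) e₁≢e₂
    (inj₁ (lose atom∈F ((c₁∈e₁ , c₂∈e₁) , (c₁∈e₂ , c₂∈e₂))))

mergeablePair⊎Reduced : (F : NegFormula n) (G : List (Subset n)) →
  (∃₂ λ A B → A ∈ₗ G × B ∈ₗ G × A ≢ B × Mergeable F A B) ⊎ Reduced F G
mergeablePair⊎Reduced F G
  with Any.any? (λ A → Any.any? (λ B → ¬? (A ≟ₛ B) ×-dec mergeable? F A B) G) G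
... | no ∄pair = inj₂ λ A∈G B∈G A≢B m → ∄pair (lose A∈G (lose B∈G (A≢B , m)))
... | yes ∃pair with find ∃pair
... | A , A∈G , ∃B with find ∃B
... | B , B∈G , A≢B , m = inj₁ (A , B , A∈G , B∈G , A≢B , m)

_without_ : List (Subset n) → Subset n → List (Subset n)
G without A = filter (λ g → ¬? (g ≟ₛ A)) G

∈-without⁺ : g ∈ₗ G → g ≢ A → g ∈ₗ G without A
∈-without⁺ = ∈-filter⁺ (λ g → ¬? (g ≟ₛ _))

∈-without⁻ : g ∈ₗ G without A → g ∈ₗ G
∈-without⁻ {G = G} = proj₁ ∘ ∈-filter⁻ (λ g → ¬? (g ≟ₛ _)) {xs = G}

length-without : A ∈ₗ G → length (G without A) < length G
length-without {G = G} A∈G =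
  filter-notAll (λ g → ¬? (g ≟ₛ _)) G (lose A∈G (λ A≢A → A≢A refl))

merge : Subset n → Subset n → List (Subset n) → List (Subset n)
merge A B G = (A ∪ B) ∷ (G without A) without B

length-merge : A ∈ₗ G → B ∈ₗ G → A ≢ B → length (merge A B G) < length G
length-merge A∈G B∈G A≢B =
  ≤-<-trans (length-without (∈-without⁺ B∈G (A≢B ∘ sym))) (length-without A∈G)

∈-merge⁻ : g ∈ₗ merge A B G → g ≡ A ∪ B ⊎ g ∈ₗ G
∈-merge⁻ (here g≡A∪B) = inj₁ g≡A∪B
∈-merge⁻ (there g∈G∖A∖B) = inj₂ (∈-without⁻ (∈-without⁻ g∈G∖A∖B))

≤H-merge : ⟦ G ⟧ ≤H ⟦ merge A B G ⟧
≤H-merge {_} {G} {A} {B} g g∈G with g ≟ₛ A | g ≟ₛ B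
... | yes refl | _ = A ∪ B , ∈E⟦⟧⁺ {G = merge A B G} (here refl) , p⊆p∪q B
... | no _ | yes refl = A ∪ B , ∈E⟦⟧⁺ {G = merge A B G} (here refl) , q⊆p∪q A B
... | no g≢A | no g≢B =
  g , ∈E⟦⟧⁺ {G = merge A B G} (there (∈-without⁺ (∈-without⁺ g∈ₗG g≢A) g≢B)) , ⊆-refl
  where g∈ₗG = ∈E⟦⟧⁻ {G = G} g∈G

module _ {d : ℕ} (Δ : Family d) (F : NegFormula d) where
  LowerBound : Family d → Set
  LowerBound Δ₀ = ∀ Δ′ → Admissible Δ F Δ′ → Δ₀ ≤H Δ′

  LeastAdmissible : Family d → Set
  LeastAdmissible ΔF = Admissible Δ F ΔF × LowerBound ΔF

  LeastAdmissible⇒MinimalAdmissible : ∀ {ΔF} → LeastAdmissible ΔF → MinimalAdmissible Δ F ΔF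
  LeastAdmissible⇒MinimalAdmissible (admissible , least) =
    admissible , λ Δ″ admissible″ Δ″≤ΔF →
      ≤H-antisym (proj₁ admissible″) (proj₁ admissible) Δ″≤ΔF (least Δ″ admissible″)

  MinimalAdmissible⇒≡H-least : ∀ {ΔF Δ′} → LeastAdmissible ΔF → MinimalAdmissible Δ F Δ′ →
                                Δ′ ≡H ΔF
  MinimalAdmissible⇒≡H-least {ΔF} {Δ′} (admissible , least) (admissible′ , minimal) e =
    sym (minimal ΔF admissible (least Δ′ admissible′) e)

  Invariant : List (Subset d) → Set
  Invariant G = Δ ≤H ⟦ G ⟧ × LowerBound ⟦ G ⟧

  Invariant-edges : Invariant (edges Δ)
  Invariant-edges =
    ≤H-reflexive (sym ∘ ⟦edges⟧≡H Δ) ,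
    λ Δ′ (_ , Δ≤Δ′ , _) → ≤H-trans (≤H-reflexive (⟦edges⟧≡H Δ)) Δ≤Δ′

  LowerBound-merge : ∀ {A B G} → LowerBound ⟦ G ⟧ → A ∈ₗ G → B ∈ₗ G → Mergeable F A B →
                     LowerBound ⟦ merge A B G ⟧
  LowerBound-merge {A} {B} {G} bound A∈G B∈G mergeable
                   Δ′ admissible@(_ , _ , noViolation) g g∈merge
    with ∈-merge⁻ {G = G} (∈E⟦⟧⁻ {G = merge A B G} g∈merge)
  ... | inj₂ g∈G = bound Δ′ admissible g (∈E⟦⟧⁺ g∈G)
  ... | inj₁ refl
    with bound Δ′ admissible A (∈E⟦⟧⁺ A∈G) | bound Δ′ admissible B (∈E⟦⟧⁺ B∈G)
  ... | e₁ , e₁∈Δ′ , A⊆e₁ | e₂ , e₂∈Δ′ , B⊆e₂ =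
    e₂ , e₂∈Δ′ , ∪-⊆-edge noViolation e₁∈Δ′ e₂∈Δ′ A⊆e₁ B⊆e₂ mergeable

  Invariant-merge : ∀ {A B G} → Invariant G → A ∈ₗ G → B ∈ₗ G → Mergeable F A B →
                    Invariant (merge A B G)
  Invariant-merge {G = G} (Δ≤G , bound) A∈G B∈G mergeable =
    ≤H-trans Δ≤G (≤H-merge {G = G}) , LowerBound-merge bound A∈G B∈G mergeable

  reduce : ∀ G → Acc _<_ (length G) → Invariant G → ∃ λ G′ → Invariant G′ × Reduced F G′
  reduce G (acc smaller) invariant with mergeablePair⊎Reduced F G
  ... | inj₂ reduced = G , invariant , reduced
  ... | inj₁ (A , B , A∈G , B∈G , A≢B , mergeable) =
    reduce (merge A B G) (smaller (length-merge A∈G B∈G A≢B))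
           (Invariant-merge invariant A∈G B∈G mergeable)

  leastAdmissible : ∃ LeastAdmissible
  leastAdmissible with reduce (edges Δ) (<-wellFounded _) Invariant-edges
  ... | G , (Δ≤G , bound) , reduced =
    ⟦ G ⟧ , (Reduced⇒IsHypergraph reduced , Δ≤G , Reduced⇒NoViolation reduced) , bound

lemma3p7 : (d : ℕ) (Δ : Family d) → IsHypergraph Δ → AllEdgesAtLeast3 Δ →
    (F : NegFormula d) →
    Σ (Family d) λ ΔF → MinimalAdmissible Δ F ΔF ×
      (∀ Δ′ → MinimalAdmissible Δ F Δ′ → Δ′ ≡H ΔF)
lemma3p7 d Δ _ _ F =
  ΔF , LeastAdmissible⇒MinimalAdmissible Δ F least ,
  λ Δ′ → MinimalAdmissible⇒≡H-least Δ F least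
  where
    ΔF = proj₁ (leastAdmissible Δ F)
    least = proj₂ (leastAdmissible Δ F)
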